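{- For any integers $n\geq 1$ and $m\geq 0$, $\mathrm{ecc}_{Y_{n,m}}(0)\geq\lfloor n(m+1)/2\rfloor$.
   Context: For integers $n\geq 1$, $m\geq 0$, the Yoke graph $Y_{n,m}$ is the simple graph whose vertices are the tuples $v=(v_0,\dots,v_{m+1})$ with $v_0,v_{m+1}\in\mathbb{Z}_n$, $v_1,\dots,v_m\in\{0,1\}$, and $\sum_{i=0}^{m+1}v_i\equiv 0 \pmod n$; $u,v$ are adjacent iff for some $0\leq i\leq m$, $u_j=v_j$ for $j\notin\{i,i+1\}$ and $(u_i,u_{i+1})=(v_i\pm1,v_{i+1}\mp1)$, with bucket coordinates $0,m+1$ computed in $\mathbb{Z}_n$ and entries staying in their allowed sets. $0$ is the all-zero vertex and $\mathrm{ecc}$ is eccentricity. -}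

module Defs where

open import Data.Nat using (ℕ; zero; suc; _+_; _*_; _≤_; _<_; NonZero)
open import Data.Nat.DivMod using (_%_; _/_)
open import Data.Fin using (Fin; toℕ; inject₁; fromℕ)
open import Data.List using (tabulate)
open import Data.Nat.ListAction using (sum)
open import Data.Product using (_×_; Σ; ∃)
open import Data.Sum using (_⊎_)
open import Relation.Binary.PropositionalEquality using (_≡_)
open import Relation.Nullary using (¬_)

IsBucket : (m : ℕ) → Fin (suc (suc m)) → Set
IsBucket m j = (toℕ j ≡ 0) ⊎ (toℕ j ≡ suc m)

-- A tuple is represented with every coordinate a natural number; bucket
-- coordinates represent elements of ℤ_n by their canonical residue in [0,n).
Tuple : ℕ → Set
Tuple m = Fin (suc (suc m)) → ℕ

record Vertex (n m : ℕ) .{{_ : NonZero n}} : Set where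
  constructor vtx
  field
    tuple   : Tuple m
    bucket  : ∀ j → IsBucket m j → tuple j < n
    middle  : ∀ j → ¬ IsBucket m j → tuple j ≤ 1
    sumCond : sum (tabulate tuple) % n ≡ 0
open Vertex public

-- Succ n m j a b : "b = a + 1" in the set of allowed values of coordinate j
-- (computed in ℤ_n at bucket coordinates, in ℕ otherwise; membership of the
-- allowed set {0,1} at middle coordinates is guaranteed by the vertex condition).
Succ : (n m : ℕ) .{{_ : NonZero n}} → Fin (suc (suc m)) → ℕ → ℕ → Set
Succ n m j a b = (IsBucket m j → b ≡ suc a % n) × (¬ IsBucket m j → b ≡ suc a)

-- Adjacency in Y_{n,m}: for some 0 ≤ i ≤ m, u_j = v_j for j ∉ {i,i+1} and
-- (u_i, u_{i+1}) = (v_i + 1, v_{i+1} - 1) or (v_i - 1, v_{i+1} + 1).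
Adj : (n m : ℕ) .{{_ : NonZero n}} → Vertex n m → Vertex n m → Set
Adj n m u v = Σ (Fin (suc m)) λ i →
    (∀ j → ¬ (j ≡ inject₁ i) → ¬ (j ≡ Fin.suc i) → tuple u j ≡ tuple v j)
  × ( (Succ n m (inject₁ i) (tuple v (inject₁ i)) (tuple u (inject₁ i))
         × Succ n m (Fin.suc i) (tuple u (Fin.suc i)) (tuple v (Fin.suc i)))
    ⊎ (Succ n m (inject₁ i) (tuple u (inject₁ i)) (tuple v (inject₁ i))
         × Succ n m (Fin.suc i) (tuple v (Fin.suc i)) (tuple u (Fin.suc i))))

data Walk (n m : ℕ) .{{_ : NonZero n}} : Vertex n m → Vertex n m → ℕ → Set where
  nil  : ∀ {u} → Walk n m u u 0
  cons : ∀ {u v w ℓ} → Adj n m u v → Walk n m v w ℓ → Walk n m u w (suc ℓ)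

zeroV : (n m : ℕ) .{{_ : NonZero n}} → Vertex n m
zeroV n m = record
  { tuple = λ _ → 0
  ; bucket = λ _ _ → nz
  ; middle = λ _ _ → Data.Nat.z≤n
  ; sumCond = sc m }
  where
    open import Data.Nat using (z≤n; s≤s; >-nonZero⁻¹)
    nz : 0 < n
    nz = >-nonZero⁻¹ n
    open import Data.Nat.DivMod using (m*n%n≡0)
    open import Relation.Binary.PropositionalEquality using (cong; trans)
    sz : ∀ k → sum (tabulate {n = k} (λ _ → 0)) ≡ 0
    sz zero = _≡_.refl
    sz (suc k) = sz k
    sc : ∀ m → sum (tabulate {n = suc (suc m)} (λ _ → 0)) % n ≡ 0
    sc m = trans (cong (_% n) (sz (suc (suc m)))) (m*n%n≡0 0 n)

-- dist(u,v) ≥ k  (vacuous if v is unreachable, i.e. dist = ∞).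
DistAtLeast : (n m : ℕ) .{{_ : NonZero n}} → Vertex n m → Vertex n m → ℕ → Set
DistAtLeast n m u v k = ∀ ℓ → Walk n m u v ℓ → k ≤ ℓ

-- ecc(u) ≥ k, i.e. max_v dist(u,v) ≥ k (the graph is finite, so the max is attained).
EccAtLeast : (n m : ℕ) .{{_ : NonZero n}} → Vertex n m → ℕ → Set
EccAtLeast n m u k = ∃ λ v → DistAtLeast n m u v k

{-# OPTIONS --safe #-}
module Submission where

open import Defs
open import Data.Nat using (ℕ; zero; suc; _+_; _*_; _∸_; _≤_; _<_; z≤n; s≤s; s≤s⁻¹; z<s; s<s; NonZero)
open import Data.Nat.Properties
open import Data.Nat.DivMod using (_/_; _%_; m≡m%n+[m/n]*n; m%n<n; m/n<m; %-distribˡ-+; m%n%n≡m%n; n%n≡0; m<n*o⇒m/o<n)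
open import Data.Nat.ListAction using (sum)
import Data.Nat.Tactic.RingSolver as ℕ-Solver
open import Data.Integer as ℤ using (ℤ; +_; -[1+_]; 0ℤ; 1ℤ; -1ℤ; ∣_∣)
import Data.Integer.Properties as ℤ
open import Data.Integer.Divisibility.Signed using (_∣_; divides; ∣m∣n⇒∣m+n; ∣m⇒∣-m)
open import Data.Integer.Tactic.RingSolver using (solve-∀)
open import Data.Fin as Fin using (Fin; toℕ; inject₁; fromℕ<)
import Data.Fin.Properties as Fin
open import Data.List using (tabulate)
open import Data.Product using (∃; _×_; _,_; proj₁; proj₂)
open import Data.Sum using (_⊎_; inj₁; inj₂)
open import Function using (_∘_; _⇔_; mk⇔; Equivalence)
open import Relation.Nullary using (¬_; yes; no; contradiction)
open import Relation.Binary.PropositionalEquality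

-- A walk from 0 lifts to an integer flow F, where F j counts the units moved across the edge
-- between coordinates j and j+1: each step changes a single F j by ±1, so a walk of length ℓ
-- ends at a vertex having a lift of ℓ¹-norm at most ℓ.  Write n = e + 2h with e = n mod 2 and
-- m + 1 = d + 2r with d = (m+1) mod 2.  Every lift of the vertex with h on the first bucket and
-- e on coordinate q = d + r (zero on the other middle coordinates) equals some c on the first q
-- edges and c - e on the last r, where c ≡ -h (mod n).  Hence |c| ≥ h and |c| + |c - e| ≥ n,
-- and the norm is at least dh + rn = ⌊n(m+1)/2⌋.

sumBelow : ℕ → (ℕ → ℕ) → ℕ
sumBelow zero    g = 0
sumBelow (suc k) g = g 0 + sumBelow k (g ∘ suc)

sumBelow-cong : ∀ k {g g′ : ℕ → ℕ} → (∀ j → j < k → g j ≡ g′ j) → sumBelow k g ≡ sumBelow k g′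
sumBelow-cong zero    eq = refl
sumBelow-cong (suc k) eq = cong₂ _+_ (eq 0 z<s) (sumBelow-cong k (λ j j<k → eq (suc j) (s<s j<k)))

sumBelow-const : ∀ k {g : ℕ → ℕ} {a} → (∀ j → j < k → g j ≡ a) → sumBelow k g ≡ k * a
sumBelow-const zero    eq = refl
sumBelow-const (suc k) eq = cong₂ _+_ (eq 0 z<s) (sumBelow-const k (λ j j<k → eq (suc j) (s<s j<k)))

sumBelow-last : ∀ k g → sumBelow (suc k) g ≡ sumBelow k g + g k
sumBelow-last zero    g = +-comm (g 0) 0
sumBelow-last (suc k) g = trans (cong (_+_ (g 0)) (sumBelow-last k (g ∘ suc))) (sym (+-assoc (g 0) _ _))

sumBelow-+ : ∀ k l g → sumBelow (k + l) g ≡ sumBelow k g + sumBelow l (λ j → g (k + j))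
sumBelow-+ zero    l g = refl
sumBelow-+ (suc k) l g = trans (cong (_+_ (g 0)) (sumBelow-+ k l (g ∘ suc))) (sym (+-assoc (g 0) _ _))

sumBelow-pointChange : ∀ k t {g g′ : ℕ → ℕ} → (∀ j → j ≢ t → g′ j ≡ g j) → g′ t ≤ suc (g t) →
                       sumBelow k g′ ≤ suc (sumBelow k g)
sumBelow-pointChange zero    t       same le = z≤n
sumBelow-pointChange (suc k) zero    same le =
  +-mono-≤ le (≤-reflexive (sumBelow-cong k (λ j _ → same (suc j) λ ())))
sumBelow-pointChange (suc k) (suc t) {g} {g′} same le = begin
  g′ 0 + sumBelow k (g′ ∘ suc)     ≤⟨ +-mono-≤ (≤-reflexive (same 0 λ ())) rest≤ ⟩
  g 0 + suc (sumBelow k (g ∘ suc)) ≡⟨ +-suc (g 0) _ ⟩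
  suc (sumBelow (suc k) g)         ∎
  where
  open ≤-Reasoning
  rest≤ : sumBelow k (g′ ∘ suc) ≤ suc (sumBelow k (g ∘ suc))
  rest≤ = sumBelow-pointChange k t (λ j j≢t → same (suc j) (j≢t ∘ suc-injective)) le

sum-tabulate-toℕ : ∀ k (g : ℕ → ℕ) → sum (tabulate {n = k} (g ∘ toℕ)) ≡ sumBelow k g
sum-tabulate-toℕ zero    g = refl
sum-tabulate-toℕ (suc k) g = cong (_+_ (g 0)) (sum-tabulate-toℕ k (g ∘ suc))

update : {A : Set} → (ℕ → A) → ℕ → A → ℕ → A
update f t x j with j ≟ t
... | yes _ = x
... | no  _ = f j

update-same : ∀ {A : Set} (f : ℕ → A) t x → update f t x t ≡ x
update-same f t x with t ≟ t
... | yes _   = refl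
... | no  t≢t = contradiction refl t≢t

update-other : ∀ {A : Set} (f : ℕ → A) t x {j} → j ≢ t → update f t x j ≡ f j
update-other f t x {j} j≢t with j ≟ t
... | yes j≡t = contradiction j≡t j≢t
... | no  _   = refl

update-≤ : ∀ {f : ℕ → ℕ} {b} t {x} → (∀ j → f j ≤ b) → x ≤ b → ∀ j → update f t x j ≤ b
update-≤ {f} t f≤b x≤b j with j ≟ t
... | yes _ = x≤b
... | no  _ = f≤b j

∣i+j∣≤1+∣i∣ : ∀ i j → ∣ j ∣ ≡ 1 → ∣ i ℤ.+ j ∣ ≤ suc ∣ i ∣
∣i+j∣≤1+∣i∣ i j ∣j∣≡1 =
  ≤-trans (ℤ.∣i+j∣≤∣i∣+∣j∣ i j) (≤-reflexive (trans (cong (_+_ ∣ i ∣) ∣j∣≡1) (+-comm ∣ i ∣ 1)))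

pos-+* : ∀ a b c → + (a + b * c) ≡ + a ℤ.+ + b ℤ.* + c
pos-+* a b c = trans (ℤ.pos-+ a (b * c)) (cong (ℤ._+_ (+ a)) (ℤ.pos-* b c))

n∣[x%n]-x : ∀ n .{{_ : NonZero n}} x → + n ∣ + (x % n) ℤ.- + x
n∣[x%n]-x n x = divides (ℤ.- + (x / n)) (begin
  + (x % n) ℤ.- + x                                 ≡⟨ cong (λ y → + (x % n) ℤ.- y) x≡ ⟩
  + (x % n) ℤ.- (+ (x % n) ℤ.+ + (x / n) ℤ.* + n)   ≡⟨ cancel (+ (x % n)) (+ (x / n)) (+ n) ⟩
  ℤ.- + (x / n) ℤ.* + n                             ∎)
  where
  open ≡-Reasoning
  x≡ : + x ≡ + (x % n) ℤ.+ + (x / n) ℤ.* + n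
  x≡ = trans (cong +_ (m≡m%n+[m/n]*n x n)) (pos-+* (x % n) (x / n) n)
  cancel : ∀ r q n → r ℤ.- (r ℤ.+ q ℤ.* n) ≡ ℤ.- q ℤ.* n
  cancel = solve-∀

residue-cases : ∀ h e c → + (e + h * 2) ∣ c ℤ.+ + h →
                ∃ λ a → c ≡ ℤ.- + (a + h) ⊎ c ≡ + (a + h + e)
residue-cases h e c (divides k c+h≡kn) = go k (trans (undo c (+ h)) (cong (ℤ._- + h) c+h≡kn))
  where
  undo : ∀ x y → x ≡ (x ℤ.+ y) ℤ.- y
  undo = solve-∀
  N : ℕ
  N = e + h * 2
  go : ∀ k → c ≡ k ℤ.* + N ℤ.- + h → ∃ λ a → c ≡ ℤ.- + (a + h) ⊎ c ≡ + (a + h + e)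
  go (+ zero)    c≡ = 0 , inj₁ (trans c≡ (zero-case (+ N) (+ h)))
    where
    zero-case : ∀ n h → 0ℤ ℤ.* n ℤ.- h ≡ ℤ.- h
    zero-case = solve-∀
  go (+ suc k)   c≡ = k * N , inj₂ (begin
    c                                    ≡⟨ c≡ ⟩
    + suc k ℤ.* + N ℤ.- + h              ≡⟨ cong (λ x → + suc k ℤ.* x ℤ.- + h) (pos-+* e h 2) ⟩
    (1ℤ ℤ.+ + k) ℤ.* (+ e ℤ.+ + h ℤ.* + 2) ℤ.- + h ≡⟨ shift (+ k) (+ e) (+ h) ⟩
    + k ℤ.* (+ e ℤ.+ + h ℤ.* + 2) ℤ.+ + h ℤ.+ + e ≡⟨ cong (λ x → + k ℤ.* x ℤ.+ + h ℤ.+ + e) (sym (pos-+* e h 2)) ⟩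
    + k ℤ.* + N ℤ.+ + h ℤ.+ + e          ≡⟨ cong (λ x → x ℤ.+ + h ℤ.+ + e) (sym (ℤ.pos-* k N)) ⟩
    + (k * N + h + e)                    ∎)
    where
    open ≡-Reasoning
    shift : ∀ k e h → (1ℤ ℤ.+ k) ℤ.* (e ℤ.+ h ℤ.* + 2) ℤ.- h ≡ k ℤ.* (e ℤ.+ h ℤ.* + 2) ℤ.+ h ℤ.+ e
    shift = solve-∀
  go -[1+ k ]    c≡ = suc k * N , inj₁ (begin
    c                                    ≡⟨ c≡ ⟩
    ℤ.- + suc k ℤ.* + N ℤ.- + h          ≡⟨ negate (+ suc k) (+ N) (+ h) ⟩
    ℤ.- (+ suc k ℤ.* + N ℤ.+ + h)        ≡⟨ cong (λ x → ℤ.- (x ℤ.+ + h)) (sym (ℤ.pos-* (suc k) N)) ⟩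
    ℤ.- + (suc k * N + h)                ∎)
    where
    open ≡-Reasoning
    negate : ∀ k n h → ℤ.- k ℤ.* n ℤ.- h ≡ ℤ.- (k ℤ.* n ℤ.+ h)
    negate = solve-∀

residue-bounds : ∀ h e c → + (e + h * 2) ∣ c ℤ.+ + h → h ≤ ∣ c ∣ × e + h * 2 ≤ ∣ c ∣ + ∣ c ℤ.- + e ∣
residue-bounds h e c n∣c+h with residue-cases h e c n∣c+h
... | a , inj₁ refl = subst (h ≤_) (sym (ℤ.∣-i∣≡∣i∣ (+ (a + h)))) (m≤n+m h a) ,
                      subst (e + h * 2 ≤_) (sym sum≡) (m≤m+n _ (a + a))
  where
  negate : ∀ x y → ℤ.- x ℤ.- y ≡ ℤ.- (x ℤ.+ y)
  negate = solve-∀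
  twice : ∀ a h e → (a + h) + (a + h + e) ≡ e + h * 2 + (a + a)
  twice = ℕ-Solver.solve-∀
  sum≡ : ∣ ℤ.- + (a + h) ∣ + ∣ ℤ.- + (a + h) ℤ.- + e ∣ ≡ e + h * 2 + (a + a)
  sum≡ = trans (cong₂ _+_ (ℤ.∣-i∣≡∣i∣ (+ (a + h)))
                          (trans (cong ∣_∣ (negate (+ (a + h)) (+ e))) (ℤ.∣-i∣≡∣i∣ (+ (a + h + e)))))
               (twice a h e)
... | a , inj₂ refl = ≤-trans (m≤n+m h a) (m≤m+n _ e) ,
                      subst (e + h * 2 ≤_) (sym sum≡) (m≤m+n _ (a + a))
  where
  cancel : ∀ x y → x ℤ.+ y ℤ.- y ≡ x
  cancel = solve-∀
  twice : ∀ a h e → (a + h + e) + (a + h) ≡ e + h * 2 + (a + a)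
  twice = ℕ-Solver.solve-∀
  sum≡ : ∣ + (a + h + e) ∣ + ∣ + (a + h + e) ℤ.- + e ∣ ≡ e + h * 2 + (a + a)
  sum≡ = trans (cong (_+_ (a + h + e)) (cong ∣_∣ (cancel (+ (a + h)) (+ e)))) (twice a h e)

negateMod : (n : ℕ) .{{_ : NonZero n}} → ℕ → ℕ
negateMod n a = (n ∸ a % n) % n

+-negateMod : ∀ n .{{_ : NonZero n}} a → (a + negateMod n a) % n ≡ 0
+-negateMod n a = begin
  (a + negateMod n a) % n                  ≡⟨ %-distribˡ-+ a _ n ⟩
  (a % n + (n ∸ a % n) % n % n) % n        ≡⟨ cong (λ x → (a % n + x) % n) (m%n%n≡m%n (n ∸ a % n) n) ⟩
  (a % n + (n ∸ a % n) % n) % n            ≡⟨ cong (λ x → (x + (n ∸ a % n) % n) % n) (m%n%n≡m%n a n) ⟨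
  (a % n % n + (n ∸ a % n) % n) % n        ≡⟨ %-distribˡ-+ (a % n) (n ∸ a % n) n ⟨
  (a % n + (n ∸ a % n)) % n                ≡⟨ cong (_% n) (m+[n∸m]≡n (<⇒≤ (m%n<n a n))) ⟩
  n % n                                    ≡⟨ n%n≡0 n ⟩
  0                                        ∎
  where open ≡-Reasoning

two-level-bound : ∀ h e d r A B → e * d ≤ 1 → h ≤ A → e + h * 2 ≤ A + B →
                  ((e + h * 2) * (d + r * 2)) / 2 ≤ (d + r) * A + r * B
two-level-bound h e d r A B ed≤1 h≤A n≤A+B = begin
  ((e + h * 2) * (d + r * 2)) / 2  ≡⟨ cong (_/ 2) (expand e h d r) ⟩
  (e * d + Y * 2) / 2              ≤⟨ s≤s⁻¹ (m<n*o⇒m/o<n (+-monoˡ-< (Y * 2) (s≤s ed≤1))) ⟩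
  d * h + r * (e + h * 2)          ≤⟨ +-mono-≤ (*-monoʳ-≤ d h≤A) (*-monoʳ-≤ r n≤A+B) ⟩
  d * A + r * (A + B)              ≡⟨ regroup d r A B ⟩
  (d + r) * A + r * B              ∎
  where
  open ≤-Reasoning
  Y : ℕ
  Y = d * h + r * (e + h * 2)
  expand : ∀ e h d r → (e + h * 2) * (d + r * 2) ≡ e * d + (d * h + r * (e + h * 2)) * 2
  expand = ℕ-Solver.solve-∀
  regroup : ∀ d r A B → d * A + r * (A + B) ≡ (d + r) * A + r * B
  regroup = ℕ-Solver.solve-∀

ZeroAt : (n m : ℕ) → Fin (suc (suc m)) → ℤ → Set
ZeroAt n m c d = (IsBucket m c → + n ∣ d) × (¬ IsBucket m c → d ≡ 0ℤ)

module _ {n m : ℕ} {c : Fin (suc (suc m))} where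

  zeroAt-0ℤ : ZeroAt n m c 0ℤ
  zeroAt-0ℤ = (λ _ → divides 0ℤ refl) , (λ _ → refl)

  zeroAt-+ : ∀ {a b} → ZeroAt n m c a → ZeroAt n m c b → ZeroAt n m c (a ℤ.+ b)
  zeroAt-+ (n∣a , a≡0) (n∣b , b≡0) =
    (λ isBucket → ∣m∣n⇒∣m+n (n∣a isBucket) (n∣b isBucket)) ,
    (λ isMiddle → cong₂ ℤ._+_ (a≡0 isMiddle) (b≡0 isMiddle))

  zeroAt-neg : ∀ {a} → ZeroAt n m c a → ZeroAt n m c (ℤ.- a)
  zeroAt-neg (n∣a , a≡0) = (λ isBucket → ∣m⇒∣-m (n∣a isBucket)) , (λ isMiddle → cong ℤ.-_ (a≡0 isMiddle))

  zeroAt-transfer : ∀ {a b} → ZeroAt n m c (b ℤ.- a) → ZeroAt n m c a ⇔ ZeroAt n m c b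
  zeroAt-transfer {a} {b} zeroAt-b-a = mk⇔
    (λ zeroAt-a → subst (ZeroAt n m c) (a+[b-a]≡b a b) (zeroAt-+ zeroAt-a zeroAt-b-a))
    (λ zeroAt-b → subst (ZeroAt n m c) (b-[b-a]≡a a b) (zeroAt-+ zeroAt-b (zeroAt-neg zeroAt-b-a)))
    where
    a+[b-a]≡b : ∀ a b → a ℤ.+ (b ℤ.- a) ≡ b
    a+[b-a]≡b = solve-∀
    b-[b-a]≡a : ∀ a b → b ℤ.+ ℤ.- (b ℤ.- a) ≡ a
    b-[b-a]≡a = solve-∀

  succ⇒zeroAt : .{{_ : NonZero n}} → ∀ {a b} → Succ n m c a b → ZeroAt n m c (+ b ℤ.- + suc a)
  succ⇒zeroAt {a} (b≡[1+a]%n , b≡1+a) =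
    (λ isBucket → subst (λ b → + n ∣ + b ℤ.- + suc a) (sym (b≡[1+a]%n isBucket)) (n∣[x%n]-x n (suc a))) ,
    (λ isMiddle → ℤ.i≡j⇒i-j≡0 (cong +_ (b≡1+a isMiddle)))

inflow : (ℕ → ℤ) → ℕ → ℤ
inflow F zero    = 0ℤ
inflow F (suc k) = F k

module _ (n m : ℕ) .{{_ : NonZero n}} where

  -- F lifts v when moving F j units rightwards across each edge j turns 0 into v.  The outflow
  -- F (suc m) of the last bucket is constrained like the others but never moved.
  defect : Vertex n m → (ℕ → ℤ) → Fin (suc (suc m)) → ℤ
  defect v F c = inflow F (toℕ c) ℤ.- F (toℕ c) ℤ.- + tuple v c

  Lift : Vertex n m → (ℕ → ℤ) → Set
  Lift v F = ∀ c → ZeroAt n m c (defect v F c)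

  record UnitMove (u v : Vertex n m) (i : Fin (suc m)) : Set where
    field
      unchanged : ∀ j → j ≢ inject₁ i → j ≢ Fin.suc i → tuple u j ≡ tuple v j
      source    : Succ n m (inject₁ i) (tuple v (inject₁ i)) (tuple u (inject₁ i))
      target    : Succ n m (Fin.suc i) (tuple u (Fin.suc i)) (tuple v (Fin.suc i))

record IncrementedAt (t : ℕ) (F F′ : ℕ → ℤ) : Set where
  field
    at        : F′ t ≡ F t ℤ.+ 1ℤ
    elsewhere : ∀ j → j ≢ t → F′ j ≡ F j

  inflow-elsewhere : ∀ k → k ≢ suc t → inflow F′ k ≡ inflow F k
  inflow-elsewhere zero    _      = refl
  inflow-elsewhere (suc k) k≢1+t = elsewhere k (k≢1+t ∘ cong suc)

module _ {n m : ℕ} .{{_ : NonZero n}} where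

  adj⇒unitMove : ∀ {u v} → Adj n m u v → ∃ λ i → UnitMove n m u v i ⊎ UnitMove n m v u i
  adj⇒unitMove (i , unchanged , inj₁ (source , target)) = i , inj₁ (record
    { unchanged = unchanged ; source = source ; target = target })
  adj⇒unitMove (i , unchanged , inj₂ (source , target)) = i , inj₂ (record
    { unchanged = λ j j≢i j≢1+i → sym (unchanged j j≢i j≢1+i) ; source = source ; target = target })

  defect-move : ∀ {u v i F F′} → UnitMove n m u v i → IncrementedAt (toℕ i) F F′ →
                ∀ c → ZeroAt n m c (defect n m v F′ c ℤ.- defect n m u F c)
  defect-move {u} {v} {i} {F} {F′} move inc c with c Fin.≟ inject₁ i | c Fin.≟ Fin.suc i
  ... | yes refl | _ = subst (ZeroAt n m c) (sym difference) (succ⇒zeroAt source)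
    where
    open UnitMove move
    open IncrementedAt inc
    open ≡-Reasoning
    x y I O : ℤ
    x = + tuple u c
    y = + tuple v c
    I = inflow F (toℕ c)
    O = F (toℕ c)
    rearrange : ∀ I O x y → (I ℤ.- (O ℤ.+ 1ℤ) ℤ.- y) ℤ.- (I ℤ.- O ℤ.- x) ≡ x ℤ.- (1ℤ ℤ.+ y)
    rearrange = solve-∀
    difference : defect n m v F′ c ℤ.- defect n m u F c ≡ x ℤ.- + suc (tuple v c)
    difference = begin
      (inflow F′ (toℕ c) ℤ.- F′ (toℕ c) ℤ.- y) ℤ.- (I ℤ.- O ℤ.- x)
        ≡⟨ cong₂ (λ I′ O′ → (I′ ℤ.- O′ ℤ.- y) ℤ.- (I ℤ.- O ℤ.- x))
                 (inflow-elsewhere (toℕ c) (1+n≢n ∘ sym ∘ trans (sym (Fin.toℕ-inject₁ i))))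
                 (subst (λ k → F′ k ≡ F k ℤ.+ 1ℤ) (sym (Fin.toℕ-inject₁ i)) at) ⟩
      (I ℤ.- (O ℤ.+ 1ℤ) ℤ.- y) ℤ.- (I ℤ.- O ℤ.- x)
        ≡⟨ rearrange I O x y ⟩
      x ℤ.- + suc (tuple v c) ∎
  ... | no _ | yes refl = subst (ZeroAt n m c) (sym difference) (zeroAt-neg (succ⇒zeroAt target))
    where
    open UnitMove move
    open IncrementedAt inc
    open ≡-Reasoning
    x y : ℤ
    x = + tuple u c
    y = + tuple v c
    t : ℕ
    t = toℕ i
    rearrange : ∀ O P x y → (O ℤ.+ 1ℤ ℤ.- P ℤ.- y) ℤ.- (O ℤ.- P ℤ.- x) ≡ ℤ.- (y ℤ.- (1ℤ ℤ.+ x))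
    rearrange = solve-∀
    difference : defect n m v F′ c ℤ.- defect n m u F c ≡ ℤ.- (y ℤ.- + suc (tuple u c))
    difference = begin
      (F′ t ℤ.- F′ (suc t) ℤ.- y) ℤ.- (F t ℤ.- F (suc t) ℤ.- x)
        ≡⟨ cong₂ (λ O′ P′ → (O′ ℤ.- P′ ℤ.- y) ℤ.- (F t ℤ.- F (suc t) ℤ.- x))
                 at (elsewhere (suc t) 1+n≢n) ⟩
      (F t ℤ.+ 1ℤ ℤ.- F (suc t) ℤ.- y) ℤ.- (F t ℤ.- F (suc t) ℤ.- x)
        ≡⟨ rearrange (F t) (F (suc t)) x y ⟩
      ℤ.- (y ℤ.- + suc (tuple u c)) ∎
  ... | no c≢i | no c≢1+i = subst (ZeroAt n m c) (sym (ℤ.i≡j⇒i-j≡0 same)) zeroAt-0ℤ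
    where
    open UnitMove move
    open IncrementedAt inc
    same : defect n m v F′ c ≡ defect n m u F c
    same = trans
      (cong₂ (λ I O → I ℤ.- O ℤ.- + tuple v c)
             (inflow-elsewhere (toℕ c) (c≢1+i ∘ Fin.toℕ-injective))
             (elsewhere (toℕ c) (c≢i ∘ Fin.toℕ-injective ∘ λ eq → trans eq (sym (Fin.toℕ-inject₁ i)))))
      (cong (λ z → inflow F (toℕ c) ℤ.- F (toℕ c) ℤ.- + z) (sym (unchanged c c≢i c≢1+i)))

  lift-move : ∀ {u v i F F′} → UnitMove n m u v i → IncrementedAt (toℕ i) F F′ →
              Lift n m u F ⇔ Lift n m v F′
  lift-move move inc = mk⇔
    (λ lift c → Equivalence.to   (zeroAt-transfer (defect-move move inc c)) (lift c))
    (λ lift c → Equivalence.from (zeroAt-transfer (defect-move move inc c)) (lift c))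

norm : ℕ → (ℕ → ℤ) → ℕ
norm k F = sumBelow k (∣_∣ ∘ F)

norm-update : ∀ k t F s → ∣ s ∣ ≡ 1 → norm k (update F t (F t ℤ.+ s)) ≤ suc (norm k F)
norm-update k t F s ∣s∣≡1 = sumBelow-pointChange k t
  (λ j j≢t → cong ∣_∣ (update-other F t _ j≢t))
  (subst (_≤ suc ∣ F t ∣) (cong ∣_∣ (sym (update-same F t _))) (∣i+j∣≤1+∣i∣ (F t) s ∣s∣≡1))

update-incrementedAt : ∀ F t → IncrementedAt t F (update F t (F t ℤ.+ 1ℤ))
update-incrementedAt F t = record { at = update-same F t _ ; elsewhere = λ j → update-other F t _ }

update-decrementedAt : ∀ F t → IncrementedAt t (update F t (F t ℤ.+ -1ℤ)) F
update-decrementedAt F t = record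
  { at        = trans (cancel (F t)) (cong (ℤ._+ 1ℤ) (sym (update-same F t _)))
  ; elsewhere = λ j j≢t → sym (update-other F t _ j≢t) }
  where
  cancel : ∀ x → x ≡ x ℤ.+ -1ℤ ℤ.+ 1ℤ
  cancel = solve-∀

module _ {n m : ℕ} .{{_ : NonZero n}} where

  lift-step : ∀ {u v F} → Adj n m u v → Lift n m u F →
              ∃ λ F′ → Lift n m v F′ × norm (suc m) F′ ≤ suc (norm (suc m) F)
  lift-step {u} {v} {F} adj lift with adj⇒unitMove {n} {m} {u} {v} adj
  ... | i , inj₁ move = _ , Equivalence.to (lift-move move (update-incrementedAt F (toℕ i))) lift ,
                        norm-update (suc m) (toℕ i) F 1ℤ refl
  ... | i , inj₂ move = _ , Equivalence.from (lift-move move (update-decrementedAt F (toℕ i))) lift ,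
                        norm-update (suc m) (toℕ i) F -1ℤ refl

  lift-walk : ∀ {u w ℓ F} → Walk n m u w ℓ → Lift n m u F →
              ∃ λ F′ → Lift n m w F′ × norm (suc m) F′ ≤ norm (suc m) F + ℓ
  lift-walk nil lift = _ , lift , m≤m+n _ 0
  lift-walk {u} {ℓ = suc ℓ} {F} (cons {v = v} adj walk) lift with lift-step {u} {v} adj lift
  ... | G , liftG , G≤ with lift-walk {v} walk liftG
  ... | H , liftH , H≤ = H , liftH , (begin
    norm (suc m) H          ≤⟨ H≤ ⟩
    norm (suc m) G + ℓ      ≤⟨ +-monoˡ-≤ ℓ G≤ ⟩
    suc (norm (suc m) F + ℓ) ≡⟨ +-suc _ ℓ ⟨
    norm (suc m) F + suc ℓ  ∎)
    where open ≤-Reasoning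

  lift-zeroV : Lift n m (zeroV n m) (λ _ → 0ℤ)
  lift-zeroV c = subst (ZeroAt n m c) (cong (λ I → I ℤ.- 0ℤ ℤ.- 0ℤ) (inflow-0 (toℕ c))) zeroAt-0ℤ
    where
    inflow-0 : ∀ k → 0ℤ ≡ inflow (λ _ → 0ℤ) k
    inflow-0 zero    = refl
    inflow-0 (suc k) = refl

  walk-from-zeroV : ∀ {w ℓ} → Walk n m (zeroV n m) w ℓ → ∃ λ F → Lift n m w F × norm (suc m) F ≤ ℓ
  walk-from-zeroV walk with lift-walk walk lift-zeroV
  ... | F , lift , F≤ = F , lift , subst (λ x → norm (suc m) F ≤ x + _) norm-0 F≤
    where
    norm-0 : norm (suc m) (λ _ → 0ℤ) ≡ 0
    norm-0 = trans (sumBelow-const (suc m) (λ _ _ → refl)) (*-zeroʳ (suc m))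

module Far (n m : ℕ) .{{_ : NonZero n}} where

  e h d r q : ℕ
  e = n % 2
  h = n / 2
  d = suc m % 2
  r = suc m / 2
  q = d + r

  n≡e+h*2 : n ≡ e + h * 2
  n≡e+h*2 = m≡m%n+[m/n]*n n 2

  1+m≡d+r*2 : suc m ≡ d + r * 2
  1+m≡d+r*2 = m≡m%n+[m/n]*n (suc m) 2

  1+m≡q+r : suc m ≡ q + r
  1+m≡q+r = trans 1+m≡d+r*2 (regroup d r)
    where
    regroup : ∀ d r → d + r * 2 ≡ d + r + r
    regroup = ℕ-Solver.solve-∀

  unit shape : ℕ → ℕ
  unit  = update (λ _ → 0) q e
  shape = update unit 0 h

  balance : ℕ
  balance = negateMod n (sumBelow (suc m) shape)

  coordinate : ℕ → ℕ
  coordinate = update shape (suc m) balance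

  coordinate-inner : ∀ {k} → k ≢ 0 → k ≢ suc m → coordinate k ≡ unit k
  coordinate-inner k≢0 k≢1+m = trans (update-other shape (suc m) balance k≢1+m) (update-other unit 0 h k≢0)

  far : Vertex n m
  far = vtx (coordinate ∘ toℕ) bucket<n middle≤1 sum≡0
    where
    bucket<n : ∀ c → IsBucket m c → coordinate (toℕ c) < n
    bucket<n c (inj₁ c≡0)   = subst (λ k → coordinate k < n) (sym c≡0) (m/n<m n 2 (s≤s (s≤s z≤n)))
    bucket<n c (inj₂ c≡1+m) = subst (λ k → coordinate k < n) (sym c≡1+m)
                              (subst (_< n) (sym (update-same shape (suc m) balance)) (m%n<n _ n))
    middle≤1 : ∀ c → ¬ IsBucket m c → coordinate (toℕ c) ≤ 1
    middle≤1 c inner = subst (_≤ 1) (sym (coordinate-inner (inner ∘ inj₁) (inner ∘ inj₂)))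
                       (update-≤ q (λ _ → z≤n) (≤-pred (m%n<n n 2)) (toℕ c))
    sum≡0 : sum (tabulate {n = suc (suc m)} (coordinate ∘ toℕ)) % n ≡ 0
    sum≡0 = begin
      sum (tabulate {n = suc (suc m)} (coordinate ∘ toℕ)) % n
        ≡⟨ cong (_% n) (sum-tabulate-toℕ (suc (suc m)) coordinate) ⟩
      sumBelow (suc (suc m)) coordinate % n              ≡⟨ cong (_% n) (sumBelow-last (suc m) coordinate) ⟩
      (sumBelow (suc m) coordinate + coordinate (suc m)) % n
        ≡⟨ cong₂ (λ a b → (a + b) % n)
                 (sumBelow-cong (suc m) (λ j j<1+m → update-other shape (suc m) balance (<⇒≢ j<1+m)))
                 (update-same shape (suc m) balance) ⟩
      (sumBelow (suc m) shape + balance) % n             ≡⟨ +-negateMod n (sumBelow (suc m) shape) ⟩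
      0                                                  ∎
      where open ≡-Reasoning

  0<q : 0 < q
  0<q = n≢0⇒n>0 λ q≡0 → 1+n≢0 (trans 1+m≡q+r (cong₂ _+_ q≡0 (m+n≡0⇒n≡0 d q≡0)))

  module _ {F : ℕ → ℤ} (lift : Lift n m far F) where

    far-residue : + n ∣ F 0 ℤ.+ + h
    far-residue = subst (+ n ∣_) (negate (F 0) (+ h)) (∣m⇒∣-m (proj₁ (lift Fin.zero) (inj₁ refl)))
      where
      negate : ∀ x y → ℤ.- (0ℤ ℤ.- x ℤ.- y) ≡ x ℤ.+ y
      negate = solve-∀

    far-flow : ∀ j → j < m → F (suc j) ≡ F j ℤ.- + unit (suc j)
    far-flow j j<m = subst (λ k → F (suc k) ≡ F k ℤ.- + unit (suc k)) x≡j
      (trans (solve-for-middle {F (toℕ x)} (proj₂ (lift (Fin.suc x)) inner))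
             (cong (λ c → F (toℕ x) ℤ.- + c) (coordinate-inner (λ ()) (inner ∘ inj₂))))
      where
      x : Fin (suc m)
      x = fromℕ< (m<n⇒m<1+n j<m)
      x≡j : toℕ x ≡ j
      x≡j = Fin.toℕ-fromℕ< (m<n⇒m<1+n j<m)
      inner : ¬ IsBucket m (Fin.suc x)
      inner (inj₂ 1+x≡1+m) = <-irrefl (trans (sym x≡j) (suc-injective 1+x≡1+m)) j<m
      solve-for-middle : ∀ {a b c} → a ℤ.- b ℤ.- c ≡ 0ℤ → b ≡ a ℤ.- c
      solve-for-middle {a} {b} {c} eq =
        trans (shift a b c) (trans (cong (λ z → a ℤ.- c ℤ.- z) eq) (ℤ.+-identityʳ (a ℤ.- c)))
        where
        shift : ∀ a b c → b ≡ a ℤ.- c ℤ.- (a ℤ.- b ℤ.- c)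
        shift = solve-∀

    far-profile : ∀ j → j ≤ m → (j < q → F j ≡ F 0) × (q ≤ j → F j ≡ F 0 ℤ.- + e)
    far-profile zero    _     = (λ _ → refl) , (λ q≤0 → contradiction q≤0 (<⇒≱ 0<q))
    far-profile (suc j) 1+j≤m = before , after
      where
      flow : F (suc j) ≡ F j ℤ.- + unit (suc j)
      flow = far-flow j 1+j≤m
      previous : (j < q → F j ≡ F 0) × (q ≤ j → F j ≡ F 0 ℤ.- + e)
      previous = far-profile j (<⇒≤ 1+j≤m)
      before : suc j < q → F (suc j) ≡ F 0
      before 1+j<q = trans flow (trans
        (cong₂ (λ a b → a ℤ.- + b) (proj₁ previous (<-trans (n<1+n j) 1+j<q))
                                   (update-other (λ _ → 0) q e (<⇒≢ 1+j<q)))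
        (ℤ.+-identityʳ (F 0)))
      after : q ≤ suc j → F (suc j) ≡ F 0 ℤ.- + e
      after q≤1+j with suc j ≟ q
      ... | yes 1+j≡q = trans flow
        (cong₂ (λ a b → a ℤ.- + b) (proj₁ previous (≤-reflexive 1+j≡q))
                                   (trans (cong unit 1+j≡q) (update-same (λ _ → 0) q e)))
      ... | no 1+j≢q  = trans flow (trans
        (cong₂ (λ a b → a ℤ.- + b) (proj₂ previous (s≤s⁻¹ (≤∧≢⇒< q≤1+j (1+j≢q ∘ sym))))
                                   (update-other (λ _ → 0) q e 1+j≢q))
        (ℤ.+-identityʳ (F 0 ℤ.- + e)))

    far-norm : norm (suc m) F ≡ q * ∣ F 0 ∣ + r * ∣ F 0 ℤ.- + e ∣
    far-norm = begin
      norm (suc m) F                                    ≡⟨ cong (λ k → norm k F) 1+m≡q+r ⟩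
      norm (q + r) F                                    ≡⟨ sumBelow-+ q r (∣_∣ ∘ F) ⟩
      norm q F + sumBelow r (λ j → ∣ F (q + j) ∣)
        ≡⟨ cong₂ _+_ (sumBelow-const q before) (sumBelow-const r after) ⟩
      q * ∣ F 0 ∣ + r * ∣ F 0 ℤ.- + e ∣                  ∎
      where
      open ≡-Reasoning
      before : ∀ j → j < q → ∣ F j ∣ ≡ ∣ F 0 ∣
      before j j<q = cong ∣_∣ (proj₁ (far-profile j j≤m) j<q)
        where
        j≤m : j ≤ m
        j≤m = s≤s⁻¹ (subst (j <_) (sym 1+m≡q+r) (<-≤-trans j<q (m≤m+n q r)))
      after : ∀ j → j < r → ∣ F (q + j) ∣ ≡ ∣ F 0 ℤ.- + e ∣
      after j j<r = cong ∣_∣ (proj₂ (far-profile (q + j) q+j≤m) (m≤m+n q j))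
        where
        q+j≤m : q + j ≤ m
        q+j≤m = s≤s⁻¹ (subst (q + j <_) (sym 1+m≡q+r) (+-monoʳ-< q j<r))

    far-bound : (n * suc m) / 2 ≤ norm (suc m) F
    far-bound = begin
      (n * suc m) / 2                      ≡⟨ cong₂ (λ a b → (a * b) / 2) n≡e+h*2 1+m≡d+r*2 ⟩
      ((e + h * 2) * (d + r * 2)) / 2      ≤⟨ two-level-bound h e d r _ _ e*d≤1 (proj₁ bounds) (proj₂ bounds) ⟩
      q * ∣ F 0 ∣ + r * ∣ F 0 ℤ.- + e ∣    ≡⟨ far-norm ⟨
      norm (suc m) F                       ∎
      where
      open ≤-Reasoning
      e*d≤1 : e * d ≤ 1
      e*d≤1 = *-mono-≤ (s≤s⁻¹ (m%n<n n 2)) (s≤s⁻¹ (m%n<n (suc m) 2))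
      bounds : h ≤ ∣ F 0 ∣ × e + h * 2 ≤ ∣ F 0 ∣ + ∣ F 0 ℤ.- + e ∣
      bounds = residue-bounds h e (F 0) (subst (λ N → + N ∣ F 0 ℤ.+ + h) n≡e+h*2 far-residue)

lemma4p16 : (n m : ℕ) .{{_ : NonZero n}} → EccAtLeast n m (zeroV n m) ((n * suc m) / 2)
lemma4p16 n m = far , λ ℓ walk →
  let F , lift , norm≤ℓ = walk-from-zeroV walk in ≤-trans (far-bound lift) norm≤ℓ
  where open Far n m
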